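{- Let $l > n \geq 2$ be integers, $I = \{0,\ldots,n-1\}$, $\phi_i(x) = (x+i)/l$. For $k \geq 2$ and $2 \leq i \leq k$, every cluster of type $(i,k)$ has diameter $$\frac{1}{l^k}\left(n + (n-1)(l + l^2 + \cdots + l^{i-1})\right).$$
   Context: For $0 \le i \le k$, a cluster of type $(i,k)$ is a set $\bigcup_{\omega_1\cdots\omega_i \in I^i}\phi_{\tau_1}\circ\cdots\circ\phi_{\tau_{k-i}}\circ\phi_{\omega_1}\circ\cdots\circ\phi_{\omega_i}([0,1])$ for some fixed $\tau_1\cdots\tau_{k-i} \in I^{k-i}$; i.e. a union of all level-$k$ basic intervals $\phi_{\omega_1}\circ\cdots\circ\phi_{\omega_k}([0,1])$ whose codes share a fixed prefix of length $k-i$. The unique type-$(k,k)$ cluster is the union of all level-$k$ basic intervals.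
   Formalization: Each cluster of type (i,k) is taken over ℚ: only its rational points are considered, and its diameter is the greatest distance between two rational points of the cluster. -}

module Defs where

open import Data.Nat as ℕ using (ℕ; zero; suc)
open import Data.Integer using (+_)
open import Data.Rational using (ℚ; _+_; _*_; _-_; _≤_; _/_; 0ℚ; 1ℚ)
open import Data.Fin using (Fin; toℕ)
open import Data.Vec using (Vec; []; _∷_; _++_)
open import Data.Product using (Σ; ∃; _×_)
open import Relation.Binary.PropositionalEquality using (_≡_)

ℕ→ℚ : ℕ → ℚ
ℕ→ℚ a = + a / 1

-- the rational a / b  (only used with b ≠ 0; b = 0 gives 0 by convention)
_/ℕ_ : ℕ → ℕ → ℚ
a /ℕ zero = 0ℚ
a /ℕ (suc b) = + a / suc b

φ : (l : ℕ) → ℕ → ℚ → ℚ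
φ l i x = (x + ℕ→ℚ i) * (1 /ℕ l)

Φ : (l : ℕ) {n m : ℕ} → Vec (Fin n) m → ℚ → ℚ
Φ l []      x = x
Φ l (a ∷ w) x = φ l (toℕ a) (Φ l w x)

InBasic : (l : ℕ) {n m : ℕ} → Vec (Fin n) m → ℚ → Set
InBasic l w x = Σ ℚ λ t → (0ℚ ≤ t) × (t ≤ 1ℚ) × (Φ l w t ≡ x)

-- the cluster of type (i,k) with fixed prefix τ ∈ I^(k-i):
-- union over ω ∈ I^i of φ_τ ∘ φ_ω ([0,1])
InCluster : (l n k i : ℕ) → Vec (Fin n) (k ℕ.∸ i) → ℚ → Set
InCluster l n k i τ x = Σ (Vec (Fin n) i) λ ω → InBasic l (τ ++ ω) x

IsDiameter : (ℚ → Set) → ℚ → Set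
IsDiameter S d =
  ((x y : ℚ) → S x → S y → y - x ≤ d) ×
  (Σ ℚ λ x → Σ ℚ λ y → S x × S y × (y - x ≡ d))

geomSum : ℕ → ℕ → ℕ
geomSum l zero = 0
geomSum l (suc zero) = 0
geomSum l (suc (suc j)) = geomSum l (suc j) ℕ.+ l ℕ.^ suc j

clusterDiam : (l n k i : ℕ) → ℚ
clusterDiam l n k i = (n ℕ.+ (n ℕ.∸ 1) ℕ.* geomSum l i) /ℕ (l ℕ.^ k)

-- Reading a code w ∈ I^m as a base-l numeral N(w), φ_w(t) = (t + N(w)) / l^m.  In a
-- cluster with prefix τ the points are therefore (t + N(ω) + N(τ) l^i) / l^k, where
-- t + N(ω) fills [0, 1 + (n-1)(1 + l + ⋯ + l^(i-1))]: the lower end is attained by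
-- ω = 0⋯0, t = 0 and the upper end by ω = (n-1)⋯(n-1), t = 1.

module Submission where

open import Defs
open import Data.Nat as ℕ using (ℕ; zero; suc; NonZero; _≤_; _<_; _∸_)
import Data.Nat.Properties as ℕ
open import Data.Nat.Solver using (module +-*-Solver)
open import Data.Integer as ℤ using (+_)
import Data.Integer.Properties as ℤ
open import Data.Rational as ℚ using (ℚ; 0ℚ; 1ℚ; _+_; _*_; _-_; toℚᵘ; fromℚᵘ; nonNegative)
open import Data.Rational.Properties
import Data.Rational.Solver as ℚ-Solver
import Data.Rational.Unnormalised as ℚᵘ
import Data.Rational.Unnormalised.Properties as ℚᵘ
open import Data.Fin using (Fin; toℕ; fromℕ)
import Data.Fin.Properties as Fin
open import Data.Vec using (Vec; []; _∷_; _++_; replicate)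
open import Data.Product using (Σ; _×_; _,_)
open import Relation.Binary.PropositionalEquality

fromℚᵘ-homo-+ : ∀ p q → fromℚᵘ (p ℚᵘ.+ q) ≡ fromℚᵘ p + fromℚᵘ q
fromℚᵘ-homo-+ p q = toℚᵘ-injective (ℚᵘ.≃-sym (begin
  toℚᵘ (fromℚᵘ p + fromℚᵘ q)            ≈⟨ toℚᵘ-homo-+ (fromℚᵘ p) (fromℚᵘ q) ⟩
  toℚᵘ (fromℚᵘ p) ℚᵘ.+ toℚᵘ (fromℚᵘ q)  ≈⟨ ℚᵘ.+-cong (toℚᵘ-fromℚᵘ p) (toℚᵘ-fromℚᵘ q) ⟩
  p ℚᵘ.+ q                               ≈⟨ toℚᵘ-fromℚᵘ (p ℚᵘ.+ q) ⟨
  toℚᵘ (fromℚᵘ (p ℚᵘ.+ q))              ∎))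
  where open ℚᵘ.≃-Reasoning

fromℚᵘ-homo-* : ∀ p q → fromℚᵘ (p ℚᵘ.* q) ≡ fromℚᵘ p * fromℚᵘ q
fromℚᵘ-homo-* p q = toℚᵘ-injective (ℚᵘ.≃-sym (begin
  toℚᵘ (fromℚᵘ p * fromℚᵘ q)            ≈⟨ toℚᵘ-homo-* (fromℚᵘ p) (fromℚᵘ q) ⟩
  toℚᵘ (fromℚᵘ p) ℚᵘ.* toℚᵘ (fromℚᵘ q)  ≈⟨ ℚᵘ.*-cong (toℚᵘ-fromℚᵘ p) (toℚᵘ-fromℚᵘ q) ⟩
  p ℚᵘ.* q                               ≈⟨ toℚᵘ-fromℚᵘ (p ℚᵘ.* q) ⟨
  toℚᵘ (fromℚᵘ (p ℚᵘ.* q))              ∎))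
  where open ℚᵘ.≃-Reasoning

/ℕ-*-/ℕ : ∀ a b c d → (a /ℕ b) * (c /ℕ d) ≡ (a ℕ.* c) /ℕ (b ℕ.* d)
/ℕ-*-/ℕ a zero    c d       = *-zeroˡ (c /ℕ d)
/ℕ-*-/ℕ a (suc b) c zero    rewrite ℕ.*-zeroʳ b = *-zeroʳ (a /ℕ suc b)
/ℕ-*-/ℕ a (suc b) c (suc d) = trans
  (sym (fromℚᵘ-homo-* (ℚᵘ.mkℚᵘ (+ a) b) (ℚᵘ.mkℚᵘ (+ c) d)))
  (cong (λ z → fromℚᵘ (ℚᵘ.mkℚᵘ z (d ℕ.+ b ℕ.* suc d))) (sym (ℤ.pos-* a c)))

ℕ→ℚ-homo-+ : ∀ a b → ℕ→ℚ (a ℕ.+ b) ≡ ℕ→ℚ a + ℕ→ℚ b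
ℕ→ℚ-homo-+ a b = trans
  (cong (λ z → fromℚᵘ (ℚᵘ.mkℚᵘ z 0))
    (trans (ℤ.pos-+ a b) (sym (cong₂ ℤ._+_ (ℤ.*-identityʳ (+ a)) (ℤ.*-identityʳ (+ b))))))
  (fromℚᵘ-homo-+ (ℚᵘ.mkℚᵘ (+ a) 0) (ℚᵘ.mkℚᵘ (+ b) 0))

ℕ→ℚ-homo-* : ∀ a b → ℕ→ℚ (a ℕ.* b) ≡ ℕ→ℚ a * ℕ→ℚ b
ℕ→ℚ-homo-* a b = sym (/ℕ-*-/ℕ a 1 b 1)

1/ℕ-* : ∀ a b → 1 /ℕ (a ℕ.* b) ≡ (1 /ℕ a) * (1 /ℕ b)
1/ℕ-* a b = sym (/ℕ-*-/ℕ 1 a 1 b)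

/ℕ≡ℕ→ℚ*1/ℕ : ∀ a b → a /ℕ b ≡ ℕ→ℚ a * (1 /ℕ b)
/ℕ≡ℕ→ℚ*1/ℕ a b = sym (trans (/ℕ-*-/ℕ a 1 1 b) (cong₂ _/ℕ_ (ℕ.*-identityʳ a) (ℕ.*-identityˡ b)))

n/ℕn≡1 : ∀ n .{{_ : NonZero n}} → n /ℕ n ≡ 1ℚ
n/ℕn≡1 (suc d) = fromℚᵘ-cong {ℚᵘ.mkℚᵘ (+ suc d) d} {ℚᵘ.mkℚᵘ (+ 1) 0} (ℚᵘ.*≡* (ℤ.*-comm (+ suc d) (+ 1)))

ℕ→ℚ-*-1/ℕ : ∀ n .{{_ : NonZero n}} → ℕ→ℚ n * (1 /ℕ n) ≡ 1ℚ
ℕ→ℚ-*-1/ℕ n = trans (/ℕ-*-/ℕ n 1 1 n) (trans (cong₂ _/ℕ_ (ℕ.*-identityʳ n) (ℕ.*-identityˡ n)) (n/ℕn≡1 n))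

0≤/ℕ : ∀ a b → 0ℚ ℚ.≤ a /ℕ b
0≤/ℕ a zero    = ≤-refl
0≤/ℕ a (suc b) = nonNegative⁻¹ (a /ℕ suc b) {{normalize-nonNeg a (suc b)}}

ℕ→ℚ-mono-≤ : ∀ {a b} → a ≤ b → ℕ→ℚ a ℚ.≤ ℕ→ℚ b
ℕ→ℚ-mono-≤ {a} {b} a≤b = begin
  ℕ→ℚ a                      ≡⟨ +-identityʳ (ℕ→ℚ a) ⟨
  ℕ→ℚ a + 0ℚ                 ≤⟨ +-monoʳ-≤ (ℕ→ℚ a) (0≤/ℕ (b ∸ a) 1) ⟩
  ℕ→ℚ a + ℕ→ℚ (b ∸ a)       ≡⟨ ℕ→ℚ-homo-+ a (b ∸ a) ⟨
  ℕ→ℚ (a ℕ.+ (b ∸ a))        ≡⟨ cong ℕ→ℚ (ℕ.m+[n∸m]≡n a≤b) ⟩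
  ℕ→ℚ b                      ∎
  where open ≤-Reasoning

fromDigits : (l : ℕ) {n m : ℕ} → Vec (Fin n) m → ℕ
fromDigits l []                = 0
fromDigits l {m = suc m} (a ∷ w) = fromDigits l w ℕ.+ toℕ a ℕ.* l ℕ.^ m

repunit : ℕ → ℕ → ℕ
repunit l zero    = 0
repunit l (suc i) = repunit l i ℕ.+ l ℕ.^ i

repunit≡1+geomSum : ∀ l i → repunit l (suc i) ≡ suc (geomSum l (suc i))
repunit≡1+geomSum l zero    = refl
repunit≡1+geomSum l (suc i) = cong (ℕ._+ l ℕ.^ suc i) (repunit≡1+geomSum l i)

fromDigits-++ : ∀ l {n m i} (τ : Vec (Fin n) m) (ω : Vec (Fin n) i) →
                fromDigits l (τ ++ ω) ≡ fromDigits l ω ℕ.+ fromDigits l τ ℕ.* l ℕ.^ i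
fromDigits-++ l           []      ω = sym (ℕ.+-identityʳ (fromDigits l ω))
fromDigits-++ l {m = suc m} {i} (a ∷ τ) ω
  rewrite fromDigits-++ l τ ω | ℕ.^-distribˡ-+-* l m i =
  solve 5 (λ V T a L Lᵢ → (V :+ T :* Lᵢ) :+ a :* (L :* Lᵢ) := V :+ (T :+ a :* L) :* Lᵢ)
          refl (fromDigits l ω) (fromDigits l τ) (toℕ a) (l ℕ.^ m) (l ℕ.^ i)
  where open +-*-Solver

fromDigits-≤ : ∀ l {n i} (ω : Vec (Fin (suc n)) i) → fromDigits l ω ≤ n ℕ.* repunit l i
fromDigits-≤ l           []      = ℕ.z≤n
fromDigits-≤ l {n} {suc i} (a ∷ ω) = begin
  fromDigits l ω ℕ.+ toℕ a ℕ.* l ℕ.^ i  ≤⟨ ℕ.+-mono-≤ (fromDigits-≤ l ω) (ℕ.*-monoˡ-≤ (l ℕ.^ i) (Fin.toℕ≤pred[n] a)) ⟩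
  n ℕ.* repunit l i ℕ.+ n ℕ.* l ℕ.^ i   ≡⟨ ℕ.*-distribˡ-+ n (repunit l i) (l ℕ.^ i) ⟨
  n ℕ.* repunit l (suc i)                ∎
  where open ℕ.≤-Reasoning

fromDigits-replicate-zero : ∀ l {n} i → fromDigits l (replicate {A = Fin (suc n)} i Fin.zero) ≡ 0
fromDigits-replicate-zero l zero    = refl
fromDigits-replicate-zero l (suc i) = trans (ℕ.+-identityʳ _) (fromDigits-replicate-zero l i)

fromDigits-replicate-max : ∀ l {n} i → fromDigits l (replicate i (fromℕ n)) ≡ n ℕ.* repunit l i
fromDigits-replicate-max l {n} zero    = sym (ℕ.*-zeroʳ n)
fromDigits-replicate-max l {n} (suc i) rewrite fromDigits-replicate-max l {n} i | Fin.toℕ-fromℕ n =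
  sym (ℕ.*-distribˡ-+ n (repunit l i) (l ℕ.^ i))

Φ-closedForm : ∀ l .{{_ : NonZero l}} {n m} (w : Vec (Fin n) m) t →
               Φ l w t ≡ (t + ℕ→ℚ (fromDigits l w)) * (1 /ℕ (l ℕ.^ m))
Φ-closedForm l []  t = sym (trans (*-identityʳ (t + 0ℚ)) (+-identityʳ t))
Φ-closedForm l {m = suc m} (a ∷ w) t = begin
  (Φ l w t + A) * r                      ≡⟨ cong (λ z → (z + A) * r) (Φ-closedForm l w t) ⟩
  ((t + V) * s + A) * r                  ≡⟨ cong (λ z → ((t + V) * s + z) * r) A≡A*L*s ⟩
  ((t + V) * s + A * (L * s)) * r        ≡⟨ solve 6 (λ t V A L r s → ((t :+ V) :* s :+ A :* (L :* s)) :* r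
                                                               := (t :+ (V :+ A :* L)) :* (r :* s))
                                                  refl t V A L r s ⟩
  (t + (V + A * L)) * (r * s)            ≡⟨ cong₂ (λ v u → (t + v) * u) digits (1/ℕ-* l (l ℕ.^ m)) ⟨
  (t + ℕ→ℚ (fromDigits l (a ∷ w))) * (1 /ℕ (l ℕ.^ suc m)) ∎
  where
  open ≡-Reasoning
  open ℚ-Solver.+-*-Solver
  A V L r s : ℚ
  A = ℕ→ℚ (toℕ a)
  V = ℕ→ℚ (fromDigits l w)
  L = ℕ→ℚ (l ℕ.^ m)
  r = 1 /ℕ l
  s = 1 /ℕ (l ℕ.^ m)
  A≡A*L*s : A ≡ A * (L * s)
  A≡A*L*s = trans (sym (*-identityʳ A)) (cong (A *_) (sym (ℕ→ℚ-*-1/ℕ (l ℕ.^ m) {{ℕ.m^n≢0 l m}})))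
  digits : ℕ→ℚ (fromDigits l w ℕ.+ toℕ a ℕ.* l ℕ.^ m) ≡ V + A * L
  digits = trans (ℕ→ℚ-homo-+ (fromDigits l w) _) (cong (λ q → V + q) (ℕ→ℚ-homo-* (toℕ a) (l ℕ.^ m)))

IsDiameter-affine : (S : ℚ → Set) (c s D : ℚ) → 0ℚ ℚ.≤ s →
  (∀ x → S x → Σ ℚ λ u → 0ℚ ℚ.≤ u × u ℚ.≤ D × x ≡ (u + c) * s) →
  S ((0ℚ + c) * s) → S ((D + c) * s) → IsDiameter S (D * s)
IsDiameter-affine S c s D 0≤s inInterval S-lo S-hi = diam≥ , (_ , _ , S-lo , S-hi , attained)
  where
  open ℚ-Solver.+-*-Solver
  difference : ∀ u u′ → (u′ + c) * s - (u + c) * s ≡ (u′ - u) * s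
  difference u u′ = solve 4 (λ u u′ c s → (u′ :+ c) :* s :- (u :+ c) :* s := (u′ :- u) :* s) refl u u′ c s
  diam≥ : ∀ x y → S x → S y → y - x ℚ.≤ D * s
  diam≥ x y Sx Sy with inInterval x Sx | inInterval y Sy
  ... | u , 0≤u , _ , refl | u′ , _ , u′≤D , refl = begin
    (u′ + c) * s - (u + c) * s  ≡⟨ difference u u′ ⟩
    (u′ - u) * s                ≤⟨ *-monoʳ-≤-nonNeg s {{nonNegative 0≤s}} (+-mono-≤ u′≤D (neg-antimono-≤ 0≤u)) ⟩
    (D - 0ℚ) * s                ≡⟨ cong (_* s) (+-identityʳ D) ⟩
    D * s                       ∎
    where open ≤-Reasoning
  attained : (D + c) * s - (0ℚ + c) * s ≡ D * s
  attained = trans (difference 0ℚ D) (cong (_* s) (+-identityʳ D))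

module _ (l : ℕ) .{{_ : NonZero l}} {n K i : ℕ} (τ : Vec (Fin (suc n)) K) where

  private
    c s : ℚ
    c = ℕ→ℚ (fromDigits l τ ℕ.* l ℕ.^ i)
    s = 1 /ℕ (l ℕ.^ (K ℕ.+ i))

  Cluster : ℚ → Set
  Cluster x = Σ (Vec (Fin (suc n)) i) λ ω → InBasic l (τ ++ ω) x

  Φ-++ : ∀ (ω : Vec (Fin (suc n)) i) t → Φ l (τ ++ ω) t ≡ (t + ℕ→ℚ (fromDigits l ω) + c) * s
  Φ-++ ω t = begin
    Φ l (τ ++ ω) t                                                 ≡⟨ Φ-closedForm l (τ ++ ω) t ⟩
    (t + ℕ→ℚ (fromDigits l (τ ++ ω))) * s                         ≡⟨ cong (λ v → (t + ℕ→ℚ v) * s) (fromDigits-++ l τ ω) ⟩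
    (t + ℕ→ℚ (fromDigits l ω ℕ.+ fromDigits l τ ℕ.* l ℕ.^ i)) * s ≡⟨ cong (λ q → (t + q) * s) (ℕ→ℚ-homo-+ (fromDigits l ω) _) ⟩
    (t + (ℕ→ℚ (fromDigits l ω) + c)) * s                          ≡⟨ cong (_* s) (+-assoc t _ c) ⟨
    (t + ℕ→ℚ (fromDigits l ω) + c) * s                            ∎
    where open ≡-Reasoning

  cluster-diameter : IsDiameter Cluster ((1ℚ + ℕ→ℚ (n ℕ.* repunit l i)) * s)
  cluster-diameter = IsDiameter-affine _ c s _ (0≤/ℕ 1 (l ℕ.^ (K ℕ.+ i))) inInterval lowest highest
    where
    0≤1 : 0ℚ ℚ.≤ 1ℚ
    0≤1 = 0≤/ℕ 1 1
    inInterval : ∀ x → Cluster x →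
                 Σ ℚ λ u → 0ℚ ℚ.≤ u × u ℚ.≤ 1ℚ + ℕ→ℚ (n ℕ.* repunit l i) × x ≡ (u + c) * s
    inInterval _ (ω , t , 0≤t , t≤1 , refl) =
      t + ℕ→ℚ (fromDigits l ω) ,
      +-mono-≤ 0≤t (0≤/ℕ (fromDigits l ω) 1) ,
      +-mono-≤ t≤1 (ℕ→ℚ-mono-≤ (fromDigits-≤ l ω)) ,
      Φ-++ ω t
    lowest : Cluster ((0ℚ + c) * s)
    lowest = replicate i Fin.zero , 0ℚ , ≤-refl , 0≤1 ,
      trans (Φ-++ _ 0ℚ) (cong (λ v → (0ℚ + ℕ→ℚ v + c) * s) (fromDigits-replicate-zero l i))
    highest : Cluster ((1ℚ + ℕ→ℚ (n ℕ.* repunit l i) + c) * s)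
    highest = replicate i (fromℕ n) , 1ℚ , 0≤1 , ≤-refl ,
      trans (Φ-++ _ 1ℚ) (cong (λ v → (1ℚ + ℕ→ℚ v + c) * s) (fromDigits-replicate-max l i))

clusterDiam≡ : ∀ l n k i → suc i ≤ k →
  clusterDiam l (suc n) k (suc i) ≡ (1ℚ + ℕ→ℚ (n ℕ.* repunit l (suc i))) * (1 /ℕ (l ℕ.^ (k ∸ suc i ℕ.+ suc i)))
clusterDiam≡ l n k i i<k = begin
  (suc n ℕ.+ n ℕ.* g) /ℕ (l ℕ.^ k)     ≡⟨ /ℕ≡ℕ→ℚ*1/ℕ (suc n ℕ.+ n ℕ.* g) (l ℕ.^ k) ⟩
  ℕ→ℚ (suc n ℕ.+ n ℕ.* g) * s          ≡⟨ cong (_* s) (cong ℕ→ℚ numerator) ⟩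
  ℕ→ℚ (1 ℕ.+ n ℕ.* R) * s              ≡⟨ cong₂ _*_ (ℕ→ℚ-homo-+ 1 (n ℕ.* R)) (cong (λ e → 1 /ℕ (l ℕ.^ e)) (sym (ℕ.m∸n+n≡m i<k))) ⟩
  (1ℚ + ℕ→ℚ (n ℕ.* R)) * (1 /ℕ (l ℕ.^ (k ∸ suc i ℕ.+ suc i))) ∎
  where
  open ≡-Reasoning
  g = geomSum l (suc i)
  R = repunit l (suc i)
  s = 1 /ℕ (l ℕ.^ k)
  numerator : suc n ℕ.+ n ℕ.* g ≡ 1 ℕ.+ n ℕ.* R
  numerator = cong suc (trans (sym (ℕ.*-suc n g)) (cong (n ℕ.*_) (sym (repunit≡1+geomSum l i))))

lemma3p5 : (l n k i : ℕ) → 2 ≤ n → n < l → 2 ≤ k → 2 ≤ i → i ≤ k →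
    (τ : Vec (Fin n) (k ∸ i)) →
    IsDiameter (InCluster l n k i τ) (clusterDiam l n k i)
lemma3p5 (suc l) (suc n) k (suc i) _ _ _ _ i<k τ =
  subst (IsDiameter (InCluster (suc l) (suc n) k (suc i) τ))
        (sym (clusterDiam≡ (suc l) n k i i<k))
        (cluster-diameter (suc l) τ)
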